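{- Let $\Gamma$ be a finite bidirected graph with a source $q$ having no entering edges and edge capacities $c\colon E\Gamma\to\mathbb{Z}_+$. For a maximum integer bidirected $q$-flow $g$, let $\vec R_g$ (resp. $\overleftarrow R_g$) be the set of nodes $v$ reachable by a $c_g$-simple walk in the residual graph $\Gamma_g$ that starts at $q$ leaving $q$ and ends at $v$ entering $v$ (resp. leaving $v$). Let $A_g=(\vec R_g-\overleftarrow R_g)\cup(\overleftarrow R_g-\vec R_g)$, $M_g=V\Gamma-(\vec R_g\cup\overleftarrow R_g)$, let $B^g_1,\dots,B^g_k$ be the node sets of connected components of the underlying undirected graph of the subgraph of $\Gamma_g$ induced by $\vec R_g\cap\overleftarrow R_g$, and let $\Gamma'_g$ be obtained from $\Gamma$ by flipping the set $\overleftarrow R_g-\vec R_g$. Then the sets $\overleftarrow R_g$ are the same for all maximum integer bidirected $q$-flows $g$, and likewise the sets $\vec R_g$, the tuples $(\Gamma'_g\mid A_g,M_g;B^g_1,\dots,B^g_k)$ (up to the order of the $B$'s), and the graphs $\Gamma'_g$.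
   Context: In a bidirected graph each edge has at each end a direction (entering or leaving that end); loops leaving twice or entering twice are allowed. A walk is a sequence $v_0,e_1,v_1,\dots,e_k,v_k$ where $e_i$ joins $v_{i-1},v_i$ and for $0<i<k$ one of $e_i,e_{i+1}$ enters and the other leaves $v_i$. For $f\ge0$ on edges, $\mathrm{div}_f(v)=f(\delta^{out}(v))-f(\delta^{in}(v))$ with loops counted twice. An integer bidirected $q$-flow is $g\colon E\Gamma\to\mathbb{Z}_+$ with $\mathrm{div}_g(v)=0$ for all $v\ne q$; its value is $\mathrm{div}_g(q)$; it is feasible if $g\le c$; maximum means feasible of maximum value. Residual graph $\Gamma_g$: node set $V\Gamma$; each $e$ with $g(e)<c(e)$ with residual capacity $c_g(e)=c(e)-g(e)$, and for each $e$ with $g(e)>0$ a reverse edge $e^R$ with both end-directions reversed and $c_g(e^R)=g(e)$. A walk is $c_g$-simple if it traverses each edge $e$ at most $c_g(e)$ times. Flipping a set $X\subseteq V\Gamma-\{q\}$ reverses the direction of every edge at each of its ends lying in $X$. -}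

module Defs where

open import Data.Nat using (ℕ; zero; suc; _+_; _*_; _∸_; _≤_; _<_)
open import Data.Integer as ℤ using (ℤ; +_)
open import Data.Fin using (Fin) renaming (_≟_ to _≟ᶠ_)
open import Data.Fin.Subset using (Subset; _∈_; _∉_)
open import Data.List using (List; []; _∷_; tabulate)
open import Data.Nat.ListAction using (sum)
open import Data.Product using (Σ; ∃; ∃-syntax; _×_; _,_)
open import Data.Sum using (_⊎_; inj₁; inj₂)
open import Relation.Nullary using (¬_; yes; no)
open import Relation.Binary.PropositionalEquality using (_≡_)
open import Relation.Binary.Construct.Closure.ReflexiveTransitive using (Star)
open import Function.Bundles using (_⇔_)

data Dir : Set where
  leave enter : Dir

rev : Dir → Dir
rev leave = enter
rev enter = leave

sameDir : Dir → Dir → ℕ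
sameDir leave leave = 1
sameDir enter enter = 1
sameDir _ _ = 0

data Side : Set where
  s₁ s₂ : Side

other : Side → Side
other s₁ = s₂
other s₂ = s₁

-- Loops (both ends at the same node, with any
-- directions) are allowed, as are parallel edges.
record BiGraph (n m : ℕ) : Set where
  field
    end : Fin m → Side → Fin n
    dir : Fin m → Side → Dir
open BiGraph public

module _ {n m : ℕ} (Γ : BiGraph n m) where

  endsAt : Fin m → Fin n → Dir → ℕ
  endsAt e v d = ind s₁ + ind s₂
    where
    ind : Side → ℕ
    ind s with end Γ e s ≟ᶠ v
    ... | yes _ = sameDir (dir Γ e s) d
    ... | no  _ = 0

  -- f(δ^out(v)) and f(δ^in(v)), loops counted twice
  outFlow inFlow : (Fin m → ℕ) → Fin n → ℕ
  outFlow f v = sum (tabulate (λ e → endsAt e v leave * f e))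
  inFlow  f v = sum (tabulate (λ e → endsAt e v enter * f e))

  div : (Fin m → ℕ) → Fin n → ℤ
  div f v = + outFlow f v ℤ.- + inFlow f v

  IsQFlow : Fin n → (Fin m → ℕ) → Set
  IsQFlow q g = ∀ v → ¬ (v ≡ q) → div g v ≡ + 0

  value : Fin n → (Fin m → ℕ) → ℤ
  value q g = div g q

  Feasible : (Fin m → ℕ) → (Fin m → ℕ) → Set
  Feasible c g = ∀ e → g e ≤ c e

  IsMaxQFlow : Fin n → (Fin m → ℕ) → (Fin m → ℕ) → Set
  IsMaxQFlow q c g =
    IsQFlow q g × Feasible c g ×
    (∀ h → IsQFlow q h → Feasible c h → value q h ℤ.≤ value q g)

  -- Residual edges: inj₁ e (copy of e, present when
  -- g e < c e, capacity c e ∸ g e) and inj₂ e (reverse edge e^R, present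
  -- when g e > 0, capacity g e, both directions reversed).

  REdge : Set
  REdge = Fin m ⊎ Fin m

  rend : REdge → Side → Fin n
  rend (inj₁ e) s = end Γ e s
  rend (inj₂ e) s = end Γ e s

  rdir : REdge → Side → Dir
  rdir (inj₁ e) s = dir Γ e s
  rdir (inj₂ e) s = rev (dir Γ e s)

  module _ (c g : Fin m → ℕ) where

    InΓg : REdge → Set
    InΓg (inj₁ e) = g e < c e
    InΓg (inj₂ e) = 0 < g e

    cap : REdge → ℕ
    cap (inj₁ e) = c e ∸ g e
    cap (inj₂ e) = g e

    -- a step traverses residual edge r from its end s to its end (other s)
    Step : Set
    Step = REdge × Side

    -- Walk u du ws v dv : ws is a nonempty walk in Γ_g starting at u whose
    -- first edge has direction du at u, ending at v whose last edge has
    -- direction dv at v; at each intermediate node one of the two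
    -- consecutive edges enters and the other leaves.
    data Walk : Fin n → Dir → List Step → Fin n → Dir → Set where
      one  : ∀ r s → InΓg r →
             Walk (rend r s) (rdir r s) ((r , s) ∷ [])
                  (rend r (other s)) (rdir r (other s))
      cons : ∀ r s {ws v dv} → InΓg r →
             Walk (rend r (other s)) (rev (rdir r (other s))) ws v dv →
             Walk (rend r s) (rdir r s) ((r , s) ∷ ws) v dv

    sameR : REdge → REdge → ℕ
    sameR (inj₁ a) (inj₁ b) with a ≟ᶠ b
    ... | yes _ = 1
    ... | no  _ = 0
    sameR (inj₂ a) (inj₂ b) with a ≟ᶠ b
    ... | yes _ = 1
    ... | no  _ = 0
    sameR _ _ = 0

    count : REdge → List Step → ℕ
    count r [] = 0
    count r ((r′ , _) ∷ ws) = sameR r r′ + count r ws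

    CgSimple : List Step → Set
    CgSimple ws = ∀ r → count r ws ≤ cap r

    RFwd : Fin n → Fin n → Set
    RFwd q v = ∃[ ws ] (Walk q leave ws v enter × CgSimple ws)

    RBwd : Fin n → Fin n → Set
    RBwd q v = ∃[ ws ] (Walk q leave ws v leave × CgSimple ws)

    Aset : Fin n → Fin n → Set
    Aset q v = (RFwd q v × ¬ RBwd q v) ⊎ (RBwd q v × ¬ RFwd q v)

    Mset : Fin n → Fin n → Set
    Mset q v = ¬ RFwd q v × ¬ RBwd q v

    Both : Fin n → Fin n → Set
    Both q v = RFwd q v × RBwd q v

    Adj : Fin n → Fin n → Fin n → Set
    Adj q u v = Both q u × Both q v ×
                ∃[ r ] ∃[ s ] (InΓg r × rend r s ≡ u × rend r (other s) ≡ v)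

    IsComponent : Fin n → Subset n → Set
    IsComponent q B = ∃[ x ] (Both q x × (∀ y → (y ∈ B) ⇔ Star (Adj q) x y))

    FlipSet : Fin n → Fin n → Set
    FlipSet q v = RBwd q v × ¬ RFwd q v

  IsFlipOf : (Fin n → Set) → BiGraph n m → Set
  IsFlipOf X Γ′ = ∀ e s → end Γ′ e s ≡ end Γ e s ×
                    (X (end Γ e s) → dir Γ′ e s ≡ rev (dir Γ e s)) ×
                    (¬ X (end Γ e s) → dir Γ′ e s ≡ dir Γ e s)

_≅G_ : {n m : ℕ} → BiGraph n m → BiGraph n m → Set
Γ₁ ≅G Γ₂ = ∀ e s → end Γ₁ e s ≡ end Γ₂ e s × dir Γ₁ e s ≡ dir Γ₂ e s

module Submission where

open import Defs
open import Data.Nat using (ℕ)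
open import Data.Fin using (Fin)
open import Data.Fin.Subset using (Subset)
open import Data.Product using (_×_)
open import Relation.Binary.PropositionalEquality using (_≡_)
open import Function.Bundles using (_⇔_)

open import Data.Nat using (zero; suc; _+_; _*_; _∸_; _≤_; _<_; z≤n; s≤s)
open import Data.Nat.Properties
open import Data.Nat.Tactic.RingSolver using (solve-∀)
open import Data.Nat.ListAction using (sum)
open import Data.Integer as ℤ using (ℤ)
import Data.Integer.Properties as ℤ
import Data.Integer.Tactic.RingSolver as ℤSolver
open import Data.Fin using (zero; suc; punchIn) renaming (_≟_ to _≟ᶠ_)
open import Data.Fin.Properties using (punchInᵢ≢i)
open import Data.List using (List; []; _∷_; tabulate)
open import Data.Product using (Σ; ∃-syntax; _,_; proj₁; proj₂)
open import Data.Sum using (_⊎_; inj₁; inj₂)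
open import Data.Sum.Properties using (≡-dec; inj₁-injective; inj₂-injective)
open import Data.Empty using (⊥; ⊥-elim)
open import Data.Unit using (⊤; tt)
open import Relation.Nullary using (¬_; Dec; yes; no)
open import Relation.Nullary.Decidable using (decidable-stable)
open import Relation.Binary.Definitions using (tri<; tri≈; tri>)
open import Relation.Binary.PropositionalEquality
  using (refl; sym; trans; cong; cong₂; subst; subst₂; module ≡-Reasoning)
open import Function.Base using (_∘_)
open import Function.Bundles using (mk⇔; Equivalence)
open import Function.Related.TypeIsomorphisms using (¬-cong-⇔)
open import Data.Product.Function.NonDependent.Propositional using (_×-⇔_)
open import Data.Sum.Function.Propositional using (_⊎-⇔_)
import Relation.Binary.Construct.Closure.ReflexiveTransitive as Star
open import Relation.Binary.Bundles using (Setoid)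
open import Algebra.Properties.CommutativeMonoid.Sum +-0-commutativeMonoid
  using (sum-remove; ∑-distrib-+; sum-cong-≗; sum-replicate-zero) renaming (sum to ∑)

-- Let g and h be maximum q-flows and W a c_h-simple walk in Γ_h leaving q.
-- Augmenting h along W gives a feasible flow f.  The difference f - g,
-- read as a multiset D of residual edges of Γ_g, has excess only at q and
-- at the last node of W, so following edges of D greedily from q gives a
-- c_g-simple walk in Γ_g.  It can stop only where W ends, or back at q
-- arriving with a leaving edge, which would augment the maximum flow g.
-- Walks ending at q entering q are handled through their first edge.

∑-tabulate : ∀ {m} (f : Fin m → ℕ) → sum (tabulate f) ≡ ∑ f
∑-tabulate {zero}  f = refl
∑-tabulate {suc m} f = cong (f zero +_) (∑-tabulate (f ∘ suc))

∑-term : ∀ {m} (f : Fin m → ℕ) i → f i ≤ ∑ f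
∑-term {suc m} f i = ≤-trans (m≤m+n (f i) _) (≤-reflexive (sym (sum-remove {i = i} f)))

∑-pos : ∀ {m} (f : Fin m → ℕ) → 0 < ∑ f → ∃[ i ] 0 < f i
∑-pos {suc m} f p with f zero in eq
... | suc _ = zero , subst (0 <_) (sym eq) (s≤s z≤n)
... | zero  with ∑-pos (f ∘ suc) p
...   | i , pᵢ = suc i , pᵢ

∑-single : ∀ {m} (f : Fin m → ℕ) i → (∀ j → ¬ j ≡ i → f j ≡ 0) → ∑ f ≡ f i
∑-single {suc m} f i off = begin
  ∑ f                                ≡⟨ sum-remove {i = i} f ⟩
  f i + ∑ (λ j → f (punchIn i j))    ≡⟨ cong (f i +_) rest ⟩
  f i + 0                            ≡⟨ +-identityʳ (f i) ⟩
  f i                                ∎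
  where
  open ≡-Reasoning
  rest : ∑ (λ j → f (punchIn i j)) ≡ 0
  rest = trans (sum-cong-≗ (λ j → off (punchIn i j) (punchInᵢ≢i i j))) (sum-replicate-zero m)

∑⊎ : ∀ {m} → (Fin m ⊎ Fin m → ℕ) → ℕ
∑⊎ F = ∑ (λ e → F (inj₁ e) + F (inj₂ e))

∑⊎-cong : ∀ {m} {F G : Fin m ⊎ Fin m → ℕ} → (∀ r → F r ≡ G r) → ∑⊎ F ≡ ∑⊎ G
∑⊎-cong F≗G = sum-cong-≗ (λ e → cong₂ _+_ (F≗G (inj₁ e)) (F≗G (inj₂ e)))

∑⊎-+ : ∀ {m} (F G : Fin m ⊎ Fin m → ℕ) → ∑⊎ (λ r → F r + G r) ≡ ∑⊎ F + ∑⊎ G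
∑⊎-+ F G = trans (sum-cong-≗ (λ e → interchange (F (inj₁ e)) (G (inj₁ e)) (F (inj₂ e)) (G (inj₂ e))))
                 (∑-distrib-+ (λ e → F (inj₁ e) + F (inj₂ e)) (λ e → G (inj₁ e) + G (inj₂ e)))
  where
  interchange : ∀ a b c d → (a + b) + (c + d) ≡ (a + c) + (b + d)
  interchange = solve-∀

∑⊎-term : ∀ {m} (F : Fin m ⊎ Fin m → ℕ) r → F r ≤ ∑⊎ F
∑⊎-term F (inj₁ e) = ≤-trans (m≤m+n _ _) (∑-term (λ e → F (inj₁ e) + F (inj₂ e)) e)
∑⊎-term F (inj₂ e) = ≤-trans (m≤n+m _ _) (∑-term (λ e → F (inj₁ e) + F (inj₂ e)) e)

∑⊎-pos : ∀ {m} (F : Fin m ⊎ Fin m → ℕ) → 0 < ∑⊎ F → ∃[ r ] 0 < F r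
∑⊎-pos F p with ∑-pos _ p
... | e , pₑ with F (inj₁ e) in eq
...   | suc _ = inj₁ e , subst (0 <_) (sym eq) (s≤s z≤n)
...   | zero  = inj₂ e , pₑ

∑⊎-single : ∀ {m} (F : Fin m ⊎ Fin m → ℕ) r →
            (∀ r′ → ¬ r′ ≡ r → F r′ ≡ 0) → ∑⊎ F ≡ F r
∑⊎-single F (inj₁ e) off =
  trans (∑-single _ e λ e′ e′≢e →
           cong₂ _+_ (off (inj₁ e′) (e′≢e ∘ inj₁-injective)) (off (inj₂ e′) λ ()))
        (trans (cong (F (inj₁ e) +_) (off (inj₂ e) λ ())) (+-identityʳ _))
∑⊎-single F (inj₂ e) off =
  trans (∑-single _ e λ e′ e′≢e →
           cong₂ _+_ (off (inj₁ e′) λ ()) (off (inj₂ e′) (e′≢e ∘ inj₂-injective)))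
        (cong (_+ F (inj₂ e)) (off (inj₁ e) λ ()))

-- A direction count a records how many
-- ends at some node leave (a leave) and enter (a enter); its excess is
-- a leave - a enter.  Most balance arguments below are equalities of
-- excesses, stated in ℕ as  a ≈ₑ b.

DirCount : Set
DirCount = Dir → ℕ

0ᵈ : DirCount
0ᵈ _ = 0

_⊞_ : DirCount → DirCount → DirCount
(a ⊞ b) x = a x + b x

infixl 6 _⊞_
infix 4 _≈ₑ_

record _≈ₑ_ (a b : DirCount) : Set where
  constructor ≈ₑ-intro
  field cross : a leave + b enter ≡ a enter + b leave

excess : DirCount → ℤ
excess a = ℤ.+ a leave ℤ.- ℤ.+ a enter

≈ₑ-refl : ∀ {a} → a ≈ₑ a
≈ₑ-refl {a} = ≈ₑ-intro (+-comm (a leave) (a enter))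

≈ₑ-sym : ∀ {a b} → a ≈ₑ b → b ≈ₑ a
≈ₑ-sym {a} {b} (≈ₑ-intro e) =
  ≈ₑ-intro (trans (+-comm (b leave) (a enter)) (trans (sym e) (+-comm (a leave) (b enter))))

≈ₑ-trans : ∀ {a b c} → a ≈ₑ b → b ≈ₑ c → a ≈ₑ c
≈ₑ-trans {a} {b} {c} (≈ₑ-intro e₁) (≈ₑ-intro e₂) =
  ≈ₑ-intro (+-cancelʳ-≡ (b leave + b enter) _ _ (begin
  a leave + c enter + (b leave + b enter)   ≡⟨ shuffle (a leave) (c enter) (b leave) (b enter) ⟩
  (a leave + b enter) + (b leave + c enter) ≡⟨ cong₂ _+_ e₁ e₂ ⟩
  (a enter + b leave) + (b enter + c leave) ≡⟨ shuffle (a enter) (c leave) (b enter) (b leave) ⟨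
  a enter + c leave + (b enter + b leave)   ≡⟨ cong (a enter + c leave +_) (+-comm (b enter) (b leave)) ⟩
  a enter + c leave + (b leave + b enter)   ∎))
  where
  open ≡-Reasoning
  shuffle : ∀ p q r s → p + q + (r + s) ≡ (p + s) + (r + q)
  shuffle = solve-∀

⊞-cong : ∀ {a b c d} → a ≈ₑ b → c ≈ₑ d → a ⊞ c ≈ₑ b ⊞ d
⊞-cong {a} {b} {c} {d} (≈ₑ-intro e₁) (≈ₑ-intro e₂) = ≈ₑ-intro (begin
  (a leave + c leave) + (b enter + d enter) ≡⟨ shuffle (a leave) (c leave) (b enter) (d enter) ⟩
  (a leave + b enter) + (c leave + d enter) ≡⟨ cong₂ _+_ e₁ e₂ ⟩
  (a enter + b leave) + (c enter + d leave) ≡⟨ shuffle (a enter) (c enter) (b leave) (d leave) ⟨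
  (a enter + c enter) + (b leave + d leave) ∎)
  where
  open ≡-Reasoning
  shuffle : ∀ p q r s → (p + q) + (r + s) ≡ (p + r) + (q + s)
  shuffle = solve-∀

-- ⊞-cong with a fixed left summand, which cannot be inferred from a ⊞ b
⊞-congˡ : ∀ a {c d} → c ≈ₑ d → a ⊞ c ≈ₑ a ⊞ d
⊞-congˡ a = ⊞-cong (≈ₑ-refl {a})

⊞-cancelˡ : ∀ {a b} c → c ⊞ a ≈ₑ c ⊞ b → a ≈ₑ b
⊞-cancelˡ {a} {b} c (≈ₑ-intro e) = ≈ₑ-intro (+-cancelˡ-≡ (c leave + c enter) _ _ (begin
  c leave + c enter + (a leave + b enter)   ≡⟨ shuffle (c leave) (c enter) (a leave) (b enter) ⟩
  (c leave + a leave) + (c enter + b enter) ≡⟨ e ⟩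
  (c enter + a enter) + (c leave + b leave) ≡⟨ shuffle (c enter) (c leave) (a enter) (b leave) ⟨
  c enter + c leave + (a enter + b leave)   ≡⟨ cong (_+ (a enter + b leave)) (+-comm (c enter) (c leave)) ⟩
  c leave + c enter + (a enter + b leave)   ∎))
  where
  open ≡-Reasoning
  shuffle : ∀ p q r s → p + q + (r + s) ≡ (p + r) + (q + s)
  shuffle = solve-∀

≗⇒≈ₑ : ∀ {a b} → (∀ x → a x ≡ b x) → a ≈ₑ b
≗⇒≈ₑ {a} {b} a≗b =
  ≈ₑ-intro (trans (cong₂ _+_ (a≗b leave) (sym (a≗b enter))) (+-comm (b leave) (a enter)))

≈ₑ-setoid : Setoid _ _
≈ₑ-setoid = record
  { Carrier = DirCount ; _≈_ = _≈ₑ_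
  ; isEquivalence = record
    { refl = ≈ₑ-refl ; sym = ≈ₑ-sym ; trans = ≈ₑ-trans } }

excess-gain : ∀ {a b} c → a ≈ₑ b ⊞ c → a leave + b enter ≤ a enter + b leave → c leave ≤ c enter
excess-gain {a} {b} c (≈ₑ-intro e) le = +-cancelˡ-≤ (a leave + b enter) _ _ (begin
  a leave + b enter + c leave   ≤⟨ +-monoˡ-≤ (c leave) le ⟩
  a enter + b leave + c leave   ≡⟨ shuffle (a enter) (b leave) (c leave) ⟩
  a enter + (b leave + c leave) ≡⟨ e ⟨
  a leave + (b enter + c enter) ≡⟨ shuffle (a leave) (b enter) (c enter) ⟨
  a leave + b enter + c enter   ∎)
  where
  open ≤-Reasoning
  shuffle : ∀ p q r → p + q + r ≡ p + (q + r)
  shuffle = solve-∀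

excess-≤ : ∀ a b → excess a ℤ.≤ excess b ⇔ a leave + b enter ≤ a enter + b leave
excess-≤ a b = mk⇔ to from
  where
  shift : ∀ p q r → (ℤ.+ p ℤ.- ℤ.+ q) ℤ.+ ℤ.+ (q + r) ≡ ℤ.+ (p + r)
  shift p q r = trans (cong (λ z → (ℤ.+ p ℤ.- ℤ.+ q) ℤ.+ z) (ℤ.pos-+ q r))
                      (trans (law (ℤ.+ p) (ℤ.+ q) (ℤ.+ r)) (sym (ℤ.pos-+ p r)))
    where
    law : ∀ P Q R → (P ℤ.- Q) ℤ.+ (Q ℤ.+ R) ≡ P ℤ.+ R
    law = ℤSolver.solve-∀
  k = a enter + b enter
  lhs : excess a ℤ.+ ℤ.+ k ≡ ℤ.+ (a leave + b enter)
  lhs = shift (a leave) (a enter) (b enter)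
  rhs : excess b ℤ.+ ℤ.+ k ≡ ℤ.+ (a enter + b leave)
  rhs = trans (cong (λ z → excess b ℤ.+ ℤ.+ z) (+-comm (a enter) (b enter)))
              (trans (shift (b leave) (b enter) (a enter)) (cong (λ z → ℤ.+ z) (+-comm (b leave) (a enter))))
  to : excess a ℤ.≤ excess b → a leave + b enter ≤ a enter + b leave
  to le = ℤ.drop‿+≤+ (subst₂ ℤ._≤_ lhs rhs (ℤ.+-monoˡ-≤ (ℤ.+ k) le))
  from : a leave + b enter ≤ a enter + b leave → excess a ℤ.≤ excess b
  from le = subst₂ ℤ._≤_ (unshift lhs) (unshift rhs) (ℤ.+-monoˡ-≤ (ℤ.- ℤ.+ k) (ℤ.+≤+ le))
    where
    unshift : ∀ {X Y} → X ℤ.+ ℤ.+ k ≡ Y → Y ℤ.- ℤ.+ k ≡ X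
    unshift {X} refl = law X (ℤ.+ k)
      where
      law : ∀ X K → (X ℤ.+ K) ℤ.- K ≡ X
      law = ℤSolver.solve-∀

excess-≡ : ∀ a b → excess a ≡ excess b ⇔ a ≈ₑ b
excess-≡ a b = mk⇔
  (λ eq → ≈ₑ-intro (≤-antisym (to (excess-≤ a b) (ℤ.≤-reflexive eq))
                              (+-comm-≤ (to (excess-≤ b a) (ℤ.≤-reflexive (sym eq))))))
  (λ { (≈ₑ-intro e) → ℤ.≤-antisym (from (excess-≤ a b) (≤-reflexive e))
                                  (from (excess-≤ b a)
                                        (≤-reflexive (swap {a leave} {b enter} {a enter} {b leave} e))) })
  where
  open Equivalence
  swap : ∀ {p q r s} → p + q ≡ r + s → s + r ≡ q + p
  swap {p} {q} {r} {s} e = trans (+-comm s r) (trans (sym e) (+-comm p q))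
  +-comm-≤ : b leave + a enter ≤ b enter + a leave → a enter + b leave ≤ a leave + b enter
  +-comm-≤ le = subst₂ _≤_ (+-comm (b leave) (a enter)) (+-comm (b enter) (a leave)) le

-- A single end, as a direction count: unit d counts one end of direction
-- d, and mark p d w counts an end at node p of direction d, seen from w.

unit : Dir → DirCount
unit = sameDir

unit-self : ∀ d → unit d d ≡ 1
unit-self leave = refl
unit-self enter = refl

mark : ∀ {n} → Fin n → Dir → Fin n → DirCount
mark p d w x with p ≟ᶠ w
... | yes _ = unit d x
... | no  _ = 0

mark-here : ∀ {n} (p : Fin n) d x → mark p d p x ≡ unit d x
mark-here p d x with p ≟ᶠ p
... | yes _  = refl
... | no p≢p = ⊥-elim (p≢p refl)

mark-there : ∀ {n} {p w : Fin n} d x → ¬ p ≡ w → mark p d w x ≡ 0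
mark-there {p = p} {w} d x p≢w with p ≟ᶠ w
... | yes p≡w = ⊥-elim (p≢w p≡w)
... | no  _   = refl

mark-rev : ∀ {n} (p : Fin n) d w x → mark p (rev d) w x ≡ mark p d w (rev x)
mark-rev p d w x with p ≟ᶠ w
... | no _  = refl
... | yes _ = same-rev d x
  where
  same-rev : ∀ d x → sameDir (rev d) x ≡ sameDir d (rev x)
  same-rev leave leave = refl
  same-rev leave enter = refl
  same-rev enter leave = refl
  same-rev enter enter = refl

mark-pos : ∀ {n} (p : Fin n) d w x → 0 < mark p d w x → p ≡ w × d ≡ x
mark-pos p d w x pos with p ≟ᶠ w
... | no _    = ⊥-elim (<-irrefl refl pos)
... | yes p≡w = p≡w , same-pos d x pos
  where
  same-pos : ∀ d x → 0 < sameDir d x → d ≡ x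
  same-pos leave leave _ = refl
  same-pos enter enter _ = refl

mark-cancel : ∀ {n} (p : Fin n) d w → mark p d w ⊞ mark p (rev d) w ≈ₑ 0ᵈ
mark-cancel p d w = ≈ₑ-intro (cong (_+ 0) (begin
  M leave + mark p (rev d) w leave ≡⟨ cong (M leave +_) (mark-rev p d w leave) ⟩
  M leave + M enter                ≡⟨ +-comm (M leave) (M enter) ⟩
  M enter + M leave                ≡⟨ cong (M enter +_) (mark-rev p d w enter) ⟨
  M enter + mark p (rev d) w enter ∎))
  where
  open ≡-Reasoning
  M = mark p d w

module Ends {n m : ℕ} (Γ : BiGraph n m) where

  endsAt-marks : ∀ e w x → endsAt Γ e w x ≡
                 mark (end Γ e s₁) (dir Γ e s₁) w x + mark (end Γ e s₂) (dir Γ e s₂) w x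
  endsAt-marks e w x with end Γ e s₁ ≟ᶠ w | end Γ e s₂ ≟ᶠ w
  ... | yes _ | yes _ = refl
  ... | yes _ | no  _ = refl
  ... | no  _ | yes _ = refl
  ... | no  _ | no  _ = refl

  end-counted : ∀ e s → 1 ≤ endsAt Γ e (end Γ e s) (dir Γ e s)
  end-counted e s = ≤-trans (≤-reflexive (sym (trans (mark-here w d d) (unit-self d))))
                            (≤-trans (one-of s) (≤-reflexive (sym (endsAt-marks e w d))))
    where
    w = end Γ e s
    d = dir Γ e s
    one-of : ∀ s → mark (end Γ e s) (dir Γ e s) w d ≤
                   mark (end Γ e s₁) (dir Γ e s₁) w d + mark (end Γ e s₂) (dir Γ e s₂) w d
    one-of s₁ = m≤m+n _ _
    one-of s₂ = m≤n+m _ _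

  rEnds : REdge Γ → Fin n → DirCount
  rEnds (inj₁ e) w x = endsAt Γ e w x
  rEnds (inj₂ e) w x = endsAt Γ e w (rev x)

  rEnds-marks : ∀ r s w x → rEnds r w x ≡
                mark (rend Γ r s) (rdir Γ r s) w x + mark (rend Γ r (other s)) (rdir Γ r (other s)) w x
  rEnds-marks r s₁ w x = rEnds-marks₁ r
    where
    rEnds-marks₁ : ∀ r → rEnds r w x ≡
                   mark (rend Γ r s₁) (rdir Γ r s₁) w x + mark (rend Γ r s₂) (rdir Γ r s₂) w x
    rEnds-marks₁ (inj₁ e) = endsAt-marks e w x
    rEnds-marks₁ (inj₂ e) = trans (endsAt-marks e w (rev x))
      (sym (cong₂ _+_ (mark-rev (end Γ e s₁) (dir Γ e s₁) w x) (mark-rev (end Γ e s₂) (dir Γ e s₂) w x)))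
  rEnds-marks r s₂ w x = trans (rEnds-marks r s₁ w x)
    (+-comm (mark (rend Γ r s₁) (rdir Γ r s₁) w x) (mark (rend Γ r s₂) (rdir Γ r s₂) w x))

  endCount : (REdge Γ → ℕ) → Fin n → DirCount
  endCount d w x = ∑⊎ (λ r → d r * rEnds r w x)

  module Walks (c g : Fin m → ℕ) where

    mult : List (Step Γ c g) → REdge Γ → ℕ
    mult ws r = count Γ c g r ws

    sameR-refl : ∀ r → sameR Γ c g r r ≡ 1
    sameR-refl (inj₁ e) with e ≟ᶠ e
    ... | yes _ = refl
    ... | no e≢e = ⊥-elim (e≢e refl)
    sameR-refl (inj₂ e) with e ≟ᶠ e
    ... | yes _ = refl
    ... | no e≢e = ⊥-elim (e≢e refl)

    sameR-≢ : ∀ r′ r → ¬ r′ ≡ r → sameR Γ c g r′ r ≡ 0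
    sameR-≢ (inj₁ a) (inj₁ b) a≢b with a ≟ᶠ b
    ... | yes refl = ⊥-elim (a≢b refl)
    ... | no _ = refl
    sameR-≢ (inj₂ a) (inj₂ b) a≢b with a ≟ᶠ b
    ... | yes refl = ⊥-elim (a≢b refl)
    ... | no _ = refl
    sameR-≢ (inj₁ _) (inj₂ _) _ = refl
    sameR-≢ (inj₂ _) (inj₁ _) _ = refl

    ∑⊎-sameR : ∀ (F : REdge Γ → ℕ) r → ∑⊎ (λ r′ → sameR Γ c g r′ r * F r′) ≡ F r
    ∑⊎-sameR F r = trans (∑⊎-single _ r (λ r′ r′≢r → cong (_* F r′) (sameR-≢ r′ r r′≢r)))
                         (trans (cong (_* F r) (sameR-refl r)) (*-identityˡ (F r)))

    endCount-[] : ∀ w x → endCount (mult []) w x ≡ 0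
    endCount-[] w x = sum-replicate-zero m

    endCount-∷ : ∀ r s ws w x →
                 endCount (mult ((r , s) ∷ ws)) w x ≡ rEnds r w x + endCount (mult ws) w x
    endCount-∷ r s ws w x =
      trans (∑⊎-cong (λ r′ → *-distribʳ-+ (rEnds r′ w x) (sameR Γ c g r′ r) (mult ws r′)))
            (trans (∑⊎-+ (λ r′ → sameR Γ c g r′ r * rEnds r′ w x) (λ r′ → mult ws r′ * rEnds r′ w x))
                   (cong (_+ endCount (mult ws) w x) (∑⊎-sameR (λ r′ → rEnds r′ w x) r)))

    without : (REdge Γ → ℕ) → REdge Γ → REdge Γ → ℕ
    without d r r′ = d r′ ∸ sameR Γ c g r′ r

    sameR-≤ : ∀ (d : REdge Γ → ℕ) r → 0 < d r → ∀ r′ → sameR Γ c g r′ r ≤ d r′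
    sameR-≤ d r pos r′ with ≡-dec _≟ᶠ_ _≟ᶠ_ r′ r
    ... | yes refl = subst (_≤ d r) (sym (sameR-refl r)) pos
    ... | no r′≢r  = subst (_≤ d r′) (sym (sameR-≢ r′ r r′≢r)) z≤n

    remove-one : ∀ (d : REdge Γ → ℕ) r → 0 < d r → ∀ (F : REdge Γ → ℕ) →
                 ∑⊎ (λ r′ → d r′ * F r′) ≡ F r + ∑⊎ (λ r′ → without d r r′ * F r′)
    remove-one d r pos F = begin
      ∑⊎ (λ r′ → d r′ * F r′)
        ≡⟨ ∑⊎-cong (λ r′ → cong (_* F r′) (sym (m+[n∸m]≡n (sameR-≤ d r pos r′)))) ⟩
      ∑⊎ (λ r′ → (sameR Γ c g r′ r + without d r r′) * F r′)
        ≡⟨ ∑⊎-cong (λ r′ → *-distribʳ-+ (F r′) (sameR Γ c g r′ r) (without d r r′)) ⟩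
      ∑⊎ (λ r′ → sameR Γ c g r′ r * F r′ + without d r r′ * F r′)
        ≡⟨ ∑⊎-+ (λ r′ → sameR Γ c g r′ r * F r′) (λ r′ → without d r r′ * F r′) ⟩
      ∑⊎ (λ r′ → sameR Γ c g r′ r * F r′) + ∑⊎ (λ r′ → without d r r′ * F r′)
        ≡⟨ cong (_+ ∑⊎ (λ r′ → without d r r′ * F r′)) (∑⊎-sameR F r) ⟩
      F r + ∑⊎ (λ r′ → without d r r′ * F r′) ∎
      where open ≡-Reasoning

    mult-∷-≤ : ∀ (d : REdge Γ → ℕ) r s ws → 0 < d r → (∀ r′ → mult ws r′ ≤ without d r r′) →
               ∀ r′ → mult ((r , s) ∷ ws) r′ ≤ d r′
    mult-∷-≤ d r s ws pos ws≤ r′ =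
      ≤-trans (+-monoʳ-≤ (sameR Γ c g r′ r) (ws≤ r′)) (≤-reflexive (m+[n∸m]≡n (sameR-≤ d r pos r′)))

    cast-walk : ∀ {u du ws v dv u′ du′ v′ dv′} → u ≡ u′ → du ≡ du′ → v ≡ v′ → dv ≡ dv′ →
                Walk Γ c g u du ws v dv → Walk Γ c g u′ du′ ws v′ dv′
    cast-walk refl refl refl refl W = W

    mult-head : ∀ r s ws → 1 ≤ mult ((r , s) ∷ ws) r
    mult-head r s ws = ≤-trans (≤-reflexive (sym (sameR-refl r))) (m≤m+n _ (mult ws r))

    first-step : ∀ {u du ws v dv} → Walk Γ c g u du ws v dv →
      ∃[ r ] ∃[ s ] (rend Γ r s ≡ u × rdir Γ r s ≡ du × InΓg Γ c g r × 1 ≤ mult ws r)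
    first-step (one r s r∈)         = r , s , refl , refl , r∈ , mult-head r s []
    first-step (cons r s {ws} r∈ _) = r , s , refl , refl , r∈ , mult-head r s ws

    -- Along a walk every inner node is passed by one entering and one leaving
    -- end, so only the first and the last end contribute to the excess.
    walk-excess : ∀ {u du ws v dv} → Walk Γ c g u du ws v dv →
                  ∀ w → endCount (mult ws) w ≈ₑ mark u du w ⊞ mark v dv w
    walk-excess (one r s _) w = ≗⇒≈ₑ λ x →
      trans (endCount-∷ r s [] w x) (trans (cong (rEnds r w x +_) (endCount-[] w x))
            (trans (+-identityʳ _) (rEnds-marks r s w x)))
    walk-excess (cons r s {ws} {v} {dv} _ W) w = begin
      endCount (mult ((r , s) ∷ ws)) w ≈⟨ ≗⇒≈ₑ (endCount-∷ r s ws w) ⟩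
      rEnds r w ⊞ endCount (mult ws) w ≈⟨ ⊞-cong (≗⇒≈ₑ (rEnds-marks r s w)) (walk-excess W w) ⟩
      (A ⊞ B) ⊞ (B′ ⊞ V)               ≈⟨ ≗⇒≈ₑ (λ x → regroup (A x) (B x) (B′ x) (V x)) ⟩
      (A ⊞ V) ⊞ (B ⊞ B′)               ≈⟨ ⊞-congˡ (A ⊞ V) (mark-cancel (rend Γ r (other s)) (rdir Γ r (other s)) w) ⟩
      (A ⊞ V) ⊞ 0ᵈ                     ≈⟨ ≗⇒≈ₑ (λ x → +-identityʳ (A x + V x)) ⟩
      A ⊞ V                            ∎
      where
      open import Relation.Binary.Reasoning.Setoid ≈ₑ-setoid
      A B B′ V : DirCount
      A  = mark (rend Γ r s) (rdir Γ r s) w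
      B  = mark (rend Γ r (other s)) (rdir Γ r (other s)) w
      B′ = mark (rend Γ r (other s)) (rev (rdir Γ r (other s))) w
      V  = mark v dv w
      regroup : ∀ a b b′ v → (a + b) + (b′ + v) ≡ (a + v) + (b + b′)
      regroup = solve-∀

module Flows {n m : ℕ} (Γ : BiGraph n m) where
  open Ends Γ

  -- the ends of a flow f at w: f(δ^out(w)) leave and f(δ^in(w)) enter,
  -- so that div f w is the excess of flowEnds f w
  flowEnds : (Fin m → ℕ) → Fin n → DirCount
  flowEnds f w leave = outFlow Γ f w
  flowEnds f w enter = inFlow Γ f w

  -- the residual multiset d turns g into f: every edge e gains d (inj₁ e)
  -- (forward copies) and loses d (inj₂ e) (reverse copies)
  Represents : (f g : Fin m → ℕ) → (REdge Γ → ℕ) → Set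
  Represents f g d = ∀ e → f e + d (inj₂ e) ≡ g e + d (inj₁ e)

  private
    ∑-+₃ : (X Y Z : Fin m → ℕ) → ∑ X + (∑ Y + ∑ Z) ≡ ∑ (λ e → X e + (Y e + Z e))
    ∑-+₃ X Y Z = sym (trans (∑-distrib-+ X (λ e → Y e + Z e)) (cong (∑ X +_) (∑-distrib-+ Y Z)))

    edge-identity : ∀ L E f g d₁ d₂ → f + d₂ ≡ g + d₁ →
      L * f + (E * g + (d₁ * E + d₂ * L)) ≡ E * f + (L * g + (d₁ * L + d₂ * E))
    edge-identity L E f g d₁ d₂ eq = begin
      L * f + (E * g + (d₁ * E + d₂ * L)) ≡⟨ group L E f g d₁ d₂ ⟩
      L * (f + d₂) + E * (g + d₁)         ≡⟨ cong₂ (λ a b → L * a + E * b) eq (sym eq) ⟩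
      L * (g + d₁) + E * (f + d₂)         ≡⟨ regroup L E f g d₁ d₂ ⟩
      E * f + (L * g + (d₁ * L + d₂ * E)) ∎
      where
      open ≡-Reasoning
      group : ∀ L E f g d₁ d₂ → L * f + (E * g + (d₁ * E + d₂ * L)) ≡ L * (f + d₂) + E * (g + d₁)
      group = solve-∀
      regroup : ∀ L E f g d₁ d₂ → L * (g + d₁) + E * (f + d₂) ≡ E * f + (L * g + (d₁ * L + d₂ * E))
      regroup = solve-∀

  difference-excess : ∀ {f g} d → Represents f g d →
                      ∀ w → flowEnds f w ≈ₑ flowEnds g w ⊞ endCount d w
  difference-excess {f} {g} d rep w = ≈ₑ-intro (begin
    outFlow Γ f w + (inFlow Γ g w + endCount d w enter)
      ≡⟨ cong₂ (λ a b → a + (b + endCount d w enter)) (∑-tabulate (λ e → L e * f e))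
                                                       (∑-tabulate (λ e → E e * g e)) ⟩
    ∑ (λ e → L e * f e) + (∑ (λ e → E e * g e) + endCount d w enter)
      ≡⟨ ∑-+₃ _ _ _ ⟩
    ∑ (λ e → L e * f e + (E e * g e + (d (inj₁ e) * E e + d (inj₂ e) * L e)))
      ≡⟨ sum-cong-≗ (λ e → edge-identity (L e) (E e) (f e) (g e) (d (inj₁ e)) (d (inj₂ e)) (rep e)) ⟩
    ∑ (λ e → E e * f e + (L e * g e + (d (inj₁ e) * L e + d (inj₂ e) * E e)))
      ≡⟨ ∑-+₃ _ _ _ ⟨
    ∑ (λ e → E e * f e) + (∑ (λ e → L e * g e) + endCount d w leave)
      ≡⟨ cong₂ (λ a b → a + (b + endCount d w leave)) (∑-tabulate (λ e → E e * f e))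
                                                       (∑-tabulate (λ e → L e * g e)) ⟨
    inFlow Γ f w + (outFlow Γ g w + endCount d w leave) ∎)
    where
    open ≡-Reasoning
    L E : Fin m → ℕ
    L e = endsAt Γ e w leave
    E e = endsAt Γ e w enter

  module Augment (c g : Fin m → ℕ) (g≤c : Feasible Γ c g) where
    open Walks c g

    push : List (Step Γ c g) → Fin m → ℕ
    push ws e = (g e + mult ws (inj₁ e)) ∸ mult ws (inj₂ e)

    push-feasible : ∀ ws → CgSimple Γ c g ws → Feasible Γ c (push ws)
    push-feasible ws cs e = begin
      (g e + mult ws (inj₁ e)) ∸ mult ws (inj₂ e) ≤⟨ m∸n≤m _ (mult ws (inj₂ e)) ⟩
      g e + mult ws (inj₁ e)                     ≤⟨ +-monoʳ-≤ (g e) (cs (inj₁ e)) ⟩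
      g e + (c e ∸ g e)                          ≡⟨ m+[n∸m]≡n (g≤c e) ⟩
      c e                                        ∎
      where open ≤-Reasoning

    push-represents : ∀ ws → CgSimple Γ c g ws → Represents (push ws) g (mult ws)
    push-represents ws cs e = m∸n+n≡m (≤-trans (cs (inj₂ e)) (m≤m+n (g e) (mult ws (inj₁ e))))

    push-excess : ∀ {u du ws v dv} → Walk Γ c g u du ws v dv → CgSimple Γ c g ws →
                  ∀ w → flowEnds (push ws) w ≈ₑ flowEnds g w ⊞ (mark u du w ⊞ mark v dv w)
    push-excess {ws = ws} W cs w =
      ≈ₑ-trans (difference-excess (mult ws) (push-represents ws cs) w)
               (⊞-congˡ (flowEnds g w) (walk-excess W w))

  module MaxFlows (q : Fin n) (c : Fin m → ℕ) where

    Max : (Fin m → ℕ) → Set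
    Max = IsMaxQFlow Γ q c

    qflow-balanced : ∀ {f} → IsQFlow Γ q f → ∀ w → ¬ w ≡ q → flowEnds f w ≈ₑ 0ᵈ
    qflow-balanced {f} fl w w≢q = Equivalence.to (excess-≡ (flowEnds f w) 0ᵈ) (fl w w≢q)

    balanced-qflow : ∀ {f} → (∀ w → ¬ w ≡ q → flowEnds f w ≈ₑ 0ᵈ) → IsQFlow Γ q f
    balanced-qflow {f} bal w w≢q = Equivalence.from (excess-≡ (flowEnds f w) 0ᵈ) (bal w w≢q)

    -- two maximum flows have the same value, hence the same excess everywhere
    max-same-excess : ∀ {g h} → Max g → Max h → ∀ w → flowEnds g w ≈ₑ flowEnds h w
    max-same-excess {g} {h} (fg , g≤c , g-max) (fh , h≤c , h-max) w with w ≟ᶠ q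
    ... | yes refl = Equivalence.to (excess-≡ (flowEnds g w) (flowEnds h w))
                       (ℤ.≤-antisym (h-max g fg g≤c) (g-max h fh h≤c))
    ... | no w≢q = ≈ₑ-trans (qflow-balanced fg w w≢q) (≈ₑ-sym (qflow-balanced fh w w≢q))

    module Closed {g} (fg : IsQFlow Γ q g) (g≤c : Feasible Γ c g)
                  {du ws dv} (W : Walk Γ c g q du ws q dv) (cs : CgSimple Γ c g ws) where
      open Augment c g g≤c

      push-qflow : IsQFlow Γ q (push ws)
      push-qflow = balanced-qflow λ w w≢q → ≈ₑ-trans (push-excess W cs w)
        (⊞-cong (qflow-balanced fg w w≢q)
                (≗⇒≈ₑ {mark q du w ⊞ mark q dv w} {0ᵈ}
                       λ x → cong₂ _+_ (mark-there du x (w≢q ∘ sym)) (mark-there dv x (w≢q ∘ sym))))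

      push-at-q : flowEnds (push ws) q ≈ₑ flowEnds g q ⊞ (unit du ⊞ unit dv)
      push-at-q = ≈ₑ-trans (push-excess W cs q)
        (⊞-congˡ (flowEnds g q) (≗⇒≈ₑ {mark q du q ⊞ mark q dv q}
                                        λ x → cong₂ _+_ (mark-here q du x) (mark-here q dv x)))

    no-augmenting-walk : ∀ {g ws} → Max g → Walk Γ c g q leave ws q leave → CgSimple Γ c g ws → ⊥
    no-augmenting-walk {g} {ws} (fg , g≤c , g-max) W cs = 2≰0
      (excess-gain {b = flowEnds g q} (unit leave ⊞ unit leave) push-at-q
        (Equivalence.to (excess-≤ (flowEnds (push ws) q) (flowEnds g q))
                        (g-max (push ws) push-qflow (push-feasible ws cs))))
      where
      open Augment c g g≤c
      open Closed fg g≤c W cs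
      2≰0 : ¬ 2 ≤ 0
      2≰0 ()

    -- augmenting a maximum flow along a walk leaving q and entering q
    -- keeps the value, hence gives a maximum flow
    push-max : ∀ {h ws} (mh : Max h) → Walk Γ c h q leave ws q enter → (cs : CgSimple Γ c h ws) →
               Max (Augment.push c h (proj₁ (proj₂ mh)) ws)
    push-max {h} {ws} (fh , h≤c , h-max) W cs =
      push-qflow , push-feasible ws cs ,
      λ f ff f≤c → subst (value Γ q f ℤ.≤_) (sym same-value) (h-max f ff f≤c)
      where
      open Augment c h h≤c
      open Closed fh h≤c W cs
      same-value : value Γ q (push ws) ≡ value Γ q h
      same-value = Equivalence.from (excess-≡ _ _)
        (≈ₑ-trans push-at-q (≈ₑ-trans (⊞-congˡ (flowEnds h q) {d = 0ᵈ} (≈ₑ-intro refl))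
                                      (≗⇒≈ₑ λ x → +-identityʳ (flowEnds h q x))))

-- Starting at a node and following
-- the edges of a residual multiset, the walk passes through nodes of role
-- through, may stop at a node of role stop, and may stop at a node of role
-- stopArriving t when it arrives with direction t.

data Role : Set where
  through stop : Role
  stopArriving : Dir → Role

Stops : Role → Dir → Set
Stops through          x = ⊥
Stops stop             x = ⊤
Stops (stopArriving t) x = t ≡ x

_≟ᵈ_ : (a b : Dir) → Dec (a ≡ b)
leave ≟ᵈ leave = yes refl
enter ≟ᵈ enter = yes refl
leave ≟ᵈ enter = no λ ()
enter ≟ᵈ leave = no λ ()

stops? : ∀ t x → Dec (Stops t x)
stops? through          x = no λ ()
stops? stop             x = yes tt
stops? (stopArriving t) x = t ≟ᵈ x

-- The condition on the remaining ends at a node the walk is not at ...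
Fits : Role → DirCount → Set
Fits through          a = a leave ≡ a enter
Fits stop             a = ⊤
Fits (stopArriving t) a = a (rev t) ≤ a t

-- ... and at the node it is at, having arrived with direction δ
-- (so it has to continue with direction rev δ).
FitsCurrent : Role → Dir → DirCount → Set
FitsCurrent through          δ a = a (rev δ) ≡ suc (a δ)
FitsCurrent stop             δ a = 0 < a (rev δ)
FitsCurrent (stopArriving t) δ a = t ≡ rev δ × a δ < a (rev δ)

fitsCurrent-continues : ∀ t δ a → FitsCurrent t δ a → 0 < a (rev δ)
fitsCurrent-continues through          δ a eq      = subst (0 <_) (sym eq) (s≤s z≤n)
fitsCurrent-continues stop             δ a pos     = pos
fitsCurrent-continues (stopArriving t) δ a (_ , lt) = <-≤-trans (s≤s z≤n) lt

fits-≗ : ∀ t {a b} → (∀ x → a x ≡ b x) → Fits t a → Fits t b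
fits-≗ through          a≗b fits = trans (sym (a≗b leave)) (trans fits (a≗b enter))
fits-≗ stop             a≗b fits = fits
fits-≗ (stopArriving t) a≗b fits = subst₂ _≤_ (a≗b (rev t)) (a≗b t) fits

fitsCurrent-≗ : ∀ t δ {a b} → (∀ x → a x ≡ b x) → FitsCurrent t δ a → FitsCurrent t δ b
fitsCurrent-≗ through          δ a≗b fits = trans (sym (a≗b (rev δ))) (trans fits (cong suc (a≗b δ)))
fitsCurrent-≗ stop             δ a≗b fits = subst (0 <_) (a≗b (rev δ)) fits
fitsCurrent-≗ (stopArriving t) δ a≗b (t≡ , lt) = t≡ , subst₂ _<_ (a≗b δ) (a≗b (rev δ)) lt

-- Leaving the current node with direction rev δ uses up one of its ends.
fits-after-leaving : ∀ t δ a → FitsCurrent t δ (unit (rev δ) ⊞ a) → Fits t a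
fits-after-leaving through               leave a eq       = sym (suc-injective eq)
fits-after-leaving through               enter a eq       = suc-injective eq
fits-after-leaving stop                  δ     a _        = tt
fits-after-leaving (stopArriving .enter) leave a (refl , lt) = ≤-pred lt
fits-after-leaving (stopArriving .leave) enter a (refl , lt) = ≤-pred lt

-- Arriving at a node with direction δ′ uses up one of its ends; if the
-- walk may not stop there, it becomes the current node.
fitsCurrent-after-arriving : ∀ t δ′ a → ¬ Stops t δ′ → Fits t (unit δ′ ⊞ a) → FitsCurrent t δ′ a
fitsCurrent-after-arriving through               leave a _ eq = sym eq
fitsCurrent-after-arriving through               enter a _ eq = eq
fitsCurrent-after-arriving stop                  δ′    a ¬stop _ = ⊥-elim (¬stop tt)
fitsCurrent-after-arriving (stopArriving leave)  leave a ¬stop _ = ⊥-elim (¬stop refl)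
fitsCurrent-after-arriving (stopArriving enter)  leave a _ le = refl , le
fitsCurrent-after-arriving (stopArriving leave)  enter a _ le = refl , le
fitsCurrent-after-arriving (stopArriving enter)  enter a ¬stop _ = ⊥-elim (¬stop refl)

-- Both at once, for an edge leading from the current node back to itself.
fitsCurrent-after-loop : ∀ t δ δ′ a → ¬ Stops t δ′ →
  FitsCurrent t δ (unit (rev δ) ⊞ (unit δ′ ⊞ a)) → FitsCurrent t δ′ a
fitsCurrent-after-loop through leave leave a _ eq = suc-injective eq
fitsCurrent-after-loop through leave enter a _ eq = suc-injective (sym eq)
fitsCurrent-after-loop through enter leave a _ eq = suc-injective (sym eq)
fitsCurrent-after-loop through enter enter a _ eq = suc-injective eq
fitsCurrent-after-loop stop δ δ′ a ¬stop _ = ⊥-elim (¬stop tt)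
fitsCurrent-after-loop (stopArriving .enter) leave leave a _ (refl , lt) = refl , ≤-pred lt
fitsCurrent-after-loop (stopArriving .enter) leave enter a ¬stop (refl , _) = ⊥-elim (¬stop refl)
fitsCurrent-after-loop (stopArriving .leave) enter leave a ¬stop (refl , _) = ⊥-elim (¬stop refl)
fitsCurrent-after-loop (stopArriving .leave) enter enter a _ (refl , lt) = refl , ≤-pred lt

-- Let d be a multiset of residual edges of Γ_g within the
-- residual capacities.  If the ends of d fit the roles of all nodes, with
-- the walk currently at cur having arrived there with direction δ, then
-- following edges of d greedily yields a walk that stops at an allowed node.
-- Each step uses up one edge of d, so the sum of d bounds the length.

module Extraction {n m : ℕ} (Γ : BiGraph n m) (c g : Fin m → ℕ) (role : Fin n → Role) where
  open Ends Γ
  open Walks c g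

  Invariant : (REdge Γ → ℕ) → Fin n → Dir → Set
  Invariant d cur δ = (∀ w → ¬ w ≡ cur → Fits (role w) (endCount d w)) ×
                      FitsCurrent (role cur) δ (endCount d cur)

  Continuation : (REdge Γ → ℕ) → Fin n → Dir → Set
  Continuation d cur δ = ∃[ w ] ∃[ x ] Σ (List (Step Γ c g)) λ ws →
    Walk Γ c g cur (rev δ) ws w x × Stops (role w) x × (∀ r → mult ws r ≤ d r)

  private
    +-pos⁻ : ∀ a b → 0 < a + b → 0 < a ⊎ 0 < b
    +-pos⁻ zero    b pos = inj₂ pos
    +-pos⁻ (suc a) b _   = inj₁ (s≤s z≤n)

    *-pos⁻ : ∀ a b → 0 < a * b → 0 < a × 0 < b
    *-pos⁻ (suc a) (suc b) _ = s≤s z≤n , s≤s z≤n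
    *-pos⁻ (suc a) zero pos = ⊥-elim (<-irrefl (sym (*-zeroʳ a)) pos)

    inΓg : ∀ r → 0 < cap Γ c g r → InΓg Γ c g r
    inΓg (inj₁ e) pos = m∸n≢0⇒n<m (λ eq → <-irrefl (sym eq) pos)
    inΓg (inj₂ e) pos = pos

  next-edge : ∀ d cur δ → 0 < endCount d cur (rev δ) →
              ∃[ r ] ∃[ s ] (0 < d r × rend Γ r s ≡ cur × rdir Γ r s ≡ rev δ)
  next-edge d cur δ pos with ∑⊎-pos (λ r → d r * rEnds r cur (rev δ)) pos
  ... | r , pos-r with *-pos⁻ (d r) (rEnds r cur (rev δ)) pos-r
  ...   | d-pos , ends-pos with +-pos⁻ _ _ (subst (0 <_) (rEnds-marks r s₁ cur (rev δ)) ends-pos)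
  ...     | inj₁ pos₁ = r , s₁ , d-pos , mark-pos _ _ _ _ pos₁
  ...     | inj₂ pos₂ = r , s₂ , d-pos , mark-pos _ _ _ _ pos₂

  module Step (d : REdge Γ → ℕ) (cur : Fin n) (δ : Dir) (r : REdge Γ) (s : Side)
              (pos : 0 < d r) (at-cur : rend Γ r s ≡ cur) (dir-r : rdir Γ r s ≡ rev δ) where

    cur′ : Fin n
    cur′ = rend Γ r (other s)
    δ′ : Dir
    δ′ = rdir Γ r (other s)
    d′ : REdge Γ → ℕ
    d′ = without d r

    size-step : ∑⊎ d ≡ suc (∑⊎ d′)
    size-step = trans (∑⊎-cong (λ r′ → sym (*-identityʳ (d r′))))
                      (trans (remove-one d r pos (λ _ → 1))
                             (cong suc (∑⊎-cong (λ r′ → *-identityʳ (d′ r′)))))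

    ends-step : ∀ w x → endCount d w x ≡ mark cur (rev δ) w x + (mark cur′ δ′ w x + endCount d′ w x)
    ends-step w x = begin
      endCount d w x                                            ≡⟨ remove-one d r pos (λ r′ → rEnds r′ w x) ⟩
      rEnds r w x + endCount d′ w x                             ≡⟨ cong (_+ endCount d′ w x) (rEnds-marks r s w x) ⟩
      mark (rend Γ r s) (rdir Γ r s) w x + mark cur′ δ′ w x + endCount d′ w x
        ≡⟨ cong₂ (λ u du → mark u du w x + mark cur′ δ′ w x + endCount d′ w x) at-cur dir-r ⟩
      mark cur (rev δ) w x + mark cur′ δ′ w x + endCount d′ w x ≡⟨ +-assoc (mark cur (rev δ) w x) _ _ ⟩
      mark cur (rev δ) w x + (mark cur′ δ′ w x + endCount d′ w x) ∎
      where open ≡-Reasoning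

    ends-elsewhere : ∀ w → ¬ cur ≡ w → ¬ cur′ ≡ w → ∀ x → endCount d w x ≡ endCount d′ w x
    ends-elsewhere w cur≢w cur′≢w x = trans (ends-step w x)
      (cong₂ _+_ (mark-there (rev δ) x cur≢w) (cong (_+ endCount d′ w x) (mark-there δ′ x cur′≢w)))

    ends-left : ¬ cur′ ≡ cur → ∀ x → endCount d cur x ≡ (unit (rev δ) ⊞ endCount d′ cur) x
    ends-left cur′≢cur x = trans (ends-step cur x)
      (cong₂ _+_ (mark-here cur (rev δ) x) (cong (_+ endCount d′ cur x) (mark-there δ′ x cur′≢cur)))

    ends-arrived : ¬ cur ≡ cur′ → ∀ x → endCount d cur′ x ≡ (unit δ′ ⊞ endCount d′ cur′) x
    ends-arrived cur≢cur′ x = trans (ends-step cur′ x)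
      (cong₂ _+_ (mark-there (rev δ) x cur≢cur′) (cong (_+ endCount d′ cur′ x) (mark-here cur′ δ′ x)))

    ends-loop : cur ≡ cur′ →
                ∀ x → endCount d cur′ x ≡ (unit (rev δ) ⊞ (unit δ′ ⊞ endCount d′ cur′)) x
    ends-loop refl x = trans (ends-step cur x)
      (cong₂ _+_ (mark-here cur (rev δ) x) (cong (_+ endCount d′ cur x) (mark-here cur δ′ x)))

    invariant : Invariant d cur δ → ¬ Stops (role cur′) δ′ → Invariant d′ cur′ δ′
    invariant (fits , fits-cur) ¬stop = fits′ , fits-cur′
      where
      fits′ : ∀ w → ¬ w ≡ cur′ → Fits (role w) (endCount d′ w)
      fits′ w w≢cur′ with cur ≟ᶠ w
      ... | yes refl = fits-after-leaving (role cur) δ (endCount d′ cur)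
                         (fitsCurrent-≗ (role cur) δ (ends-left (w≢cur′ ∘ sym)) fits-cur)
      ... | no cur≢w = fits-≗ (role w) (ends-elsewhere w cur≢w (w≢cur′ ∘ sym)) (fits w (cur≢w ∘ sym))
      fits-cur′ : FitsCurrent (role cur′) δ′ (endCount d′ cur′)
      fits-cur′ with cur ≟ᶠ cur′
      ... | yes cur≡cur′ = fitsCurrent-after-loop (role cur′) δ δ′ (endCount d′ cur′) ¬stop
                             (fitsCurrent-≗ (role cur′) δ (ends-loop cur≡cur′)
                               (subst (λ u → FitsCurrent (role u) δ (endCount d u)) cur≡cur′ fits-cur))
      ... | no cur≢cur′ = fitsCurrent-after-arriving (role cur′) δ′ (endCount d′ cur′) ¬stop
                            (fits-≗ (role cur′) (ends-arrived cur≢cur′) (fits cur′ (cur≢cur′ ∘ sym)))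

  extract : ∀ k d → ∑⊎ d ≡ k → (∀ r → d r ≤ cap Γ c g r) →
            ∀ cur δ → Invariant d cur δ → Continuation d cur δ
  extract k d d-size d≤cap cur δ inv
    with next-edge d cur δ (fitsCurrent-continues (role cur) δ (endCount d cur) (proj₂ inv))
  ... | r , s , pos , at-cur , dir-r = continue k d-size
    where
    open Step d cur δ r s pos at-cur dir-r
    inΓ : InΓg Γ c g r
    inΓ = inΓg r (<-≤-trans pos (d≤cap r))
    d′≤cap : ∀ r′ → d′ r′ ≤ cap Γ c g r′
    d′≤cap r′ = ≤-trans (m∸n≤m (d r′) (sameR Γ c g r′ r)) (d≤cap r′)
    continue : ∀ k → ∑⊎ d ≡ k → Continuation d cur δ
    continue zero    size₀ = ⊥-elim (<-irrefl refl
                               (<-≤-trans pos (≤-trans (∑⊎-term d r) (≤-reflexive size₀))))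
    continue (suc k) sizeₖ with stops? (role cur′) δ′
    ... | yes stopped = cur′ , δ′ , (r , s) ∷ [] , cast-walk at-cur dir-r refl refl (one r s inΓ) ,
                        stopped , mult-∷-≤ d r s [] pos (λ _ → z≤n)
    ... | no ¬stop
      with extract k d′ (suc-injective (trans (sym size-step) sizeₖ)) d′≤cap cur′ δ′ (invariant inv ¬stop)
    ...   | w , x , ws , W , stopped , ws≤ = w , x , (r , s) ∷ ws , cast-walk at-cur dir-r refl refl (cons r s inΓ W) ,
                                             stopped , mult-∷-≤ d r s ws pos ws≤

balanced-fits : ∀ {a} → a ≈ₑ 0ᵈ → Fits through a
balanced-fits {a} (≈ₑ-intro e) = trans (sym (+-identityʳ (a leave))) (trans e (+-identityʳ (a enter)))

≈ₑ-unit : ∀ t {a} → a ≈ₑ unit t → a t ≡ suc (a (rev t))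
≈ₑ-unit leave {a} (≈ₑ-intro e) = trans (sym (+-identityʳ (a leave))) (trans e (+-comm (a enter) 1))
≈ₑ-unit enter {a} (≈ₑ-intro e) = sym (trans (sym (+-comm (a leave) 1)) (trans e (+-identityʳ (a enter))))

unit-fits : ∀ t {a} → a ≈ₑ unit t → Fits (stopArriving t) a
unit-fits t {a} a≈t = ≤-trans (n≤1+n (a (rev t))) (≤-reflexive (sym (≈ₑ-unit t a≈t)))

leaving-fitsCurrent : ∀ {a} → a ≈ₑ unit leave → FitsCurrent (stopArriving leave) enter a
leaving-fitsCurrent a≈leave = refl , ≤-reflexive (sym (≈ₑ-unit leave a≈leave))

module Uniqueness {n m : ℕ} (Γ : BiGraph n m) (q : Fin n) (c : Fin m → ℕ)
                  (q-source : ∀ e s → end Γ e s ≡ q → dir Γ e s ≡ leave) where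
  open Ends Γ
  open Flows Γ
  open MaxFlows q c

  difference : (f g : Fin m → ℕ) → REdge Γ → ℕ
  difference f g (inj₁ e) = f e ∸ g e
  difference f g (inj₂ e) = g e ∸ f e

  difference-represents : ∀ f g → Represents f g (difference f g)
  difference-represents f g e with ≤-total (f e) (g e)
  ... | inj₁ f≤g = trans (m+[n∸m]≡n f≤g)
                         (sym (trans (cong (g e +_) (m≤n⇒m∸n≡0 f≤g)) (+-identityʳ (g e))))
  ... | inj₂ g≤f = trans (cong (f e +_) (m≤n⇒m∸n≡0 g≤f))
                         (trans (+-identityʳ (f e)) (sym (m+[n∸m]≡n g≤f)))

  difference-≤cap : ∀ {f g} → Feasible Γ c f → ∀ r → difference f g r ≤ cap Γ c g r
  difference-≤cap {f} {g} f≤c (inj₁ e) = ∸-monoˡ-≤ (g e) (f≤c e)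
  difference-≤cap {f} {g} f≤c (inj₂ e) = m∸n≤m (g e) (f e)

  walk-from-q : ∀ {g} role (d : REdge Γ → ℕ) → (∀ r → d r ≤ cap Γ c g r) →
    (∀ w → ¬ w ≡ q → Fits (role w) (endCount d w)) → FitsCurrent (role q) enter (endCount d q) →
    ∃[ w ] ∃[ x ] Σ (List (Step Γ c g)) λ ws →
      Walk Γ c g q leave ws w x × Stops (role w) x × CgSimple Γ c g ws
  walk-from-q {g} role d d≤cap fits fits-q
    with Extraction.extract Γ c g role (∑⊎ d) d refl d≤cap q enter (fits , fits-q)
  ... | w , x , ws , W , stopped , ws≤d = w , x , ws , W , stopped , λ r → ≤-trans (ws≤d r) (d≤cap r)

  -- Reaching v ≠ q with final direction x: the walk may only stop at v
  -- arriving with x, or at q arriving leaving (an augmenting walk).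
  toward : Fin n → Dir → Fin n → Role
  toward v x w with w ≟ᶠ q
  ... | yes _ = stopArriving leave
  ... | no _ with w ≟ᶠ v
  ...   | yes _ = stopArriving x
  ...   | no _  = through

  -- If Γ_h has a c_h-simple walk from q to v ≠ q, then so does Γ_g: augment
  -- h along the walk to f; the difference f - g lives in Γ_g and has excess
  -- exactly at q and v, so walk extraction from q reaches v.
  transfer : ∀ {g h} → Max g → Max h → ∀ v x → ¬ v ≡ q →
    Σ (List (Step Γ c h)) (λ ws → Walk Γ c h q leave ws v x × CgSimple Γ c h ws) →
    Σ (List (Step Γ c g)) (λ ws → Walk Γ c g q leave ws v x × CgSimple Γ c g ws)
  transfer {g} {h} mg mh@(_ , h≤c , _) v x v≢q (ws , W , cs) =
    finish (walk-from-q (toward v x) D (difference-≤cap (push-feasible ws cs)) fits fits-q)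
    where
    open Augment c h h≤c
    open import Relation.Binary.Reasoning.Setoid ≈ₑ-setoid
    D : REdge Γ → ℕ
    D = difference (push ws) g

    D-excess : ∀ w → endCount D w ≈ₑ mark q leave w ⊞ mark v x w
    D-excess w = ⊞-cancelˡ (flowEnds g w) (begin
      flowEnds g w ⊞ endCount D w ≈⟨ difference-excess D (difference-represents (push ws) g) w ⟨
      flowEnds (push ws) w        ≈⟨ push-excess W cs w ⟩
      flowEnds h w ⊞ M            ≈⟨ ⊞-cong (max-same-excess mh mg w) (≈ₑ-refl {M}) ⟩
      flowEnds g w ⊞ M            ∎)
      where
      M = mark q leave w ⊞ mark v x w

    fits : ∀ w → ¬ w ≡ q → Fits (toward v x w) (endCount D w)
    fits w w≢q with w ≟ᶠ q
    ... | yes w≡q = ⊥-elim (w≢q w≡q)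
    ... | no _ with w ≟ᶠ v
    ...   | yes refl = unit-fits x (≈ₑ-trans (D-excess w)
              (≗⇒≈ₑ λ y → cong₂ _+_ (mark-there leave y (w≢q ∘ sym)) (mark-here w x y)))
    ...   | no w≢v = balanced-fits (≈ₑ-trans (D-excess w)
              (≗⇒≈ₑ λ y → cong₂ _+_ (mark-there leave y (w≢q ∘ sym)) (mark-there x y (w≢v ∘ sym))))

    fits-q : FitsCurrent (toward v x q) enter (endCount D q)
    fits-q with q ≟ᶠ q
    ... | no q≢q = ⊥-elim (q≢q refl)
    ... | yes _ = leaving-fitsCurrent (≈ₑ-trans (D-excess q)
              (≗⇒≈ₑ λ y → trans (cong₂ _+_ (mark-here q leave y) (mark-there x y v≢q)) (+-identityʳ _)))

    finish : (∃[ w ] ∃[ y ] Σ (List (Step Γ c g)) λ ws′ →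
               Walk Γ c g q leave ws′ w y × Stops (toward v x w) y × CgSimple Γ c g ws′) →
             Σ (List (Step Γ c g)) (λ ws′ → Walk Γ c g q leave ws′ v x × CgSimple Γ c g ws′)
    finish (w , y , ws′ , W′ , stopped , cs′) with w ≟ᶠ q
    ... | yes refl =
          ⊥-elim (no-augmenting-walk mg (subst (Walk Γ c g q leave ws′ q) (sym stopped) W′) cs′)
    ... | no _ with w ≟ᶠ v
    ...   | yes refl = ws′ , subst (Walk Γ c g q leave ws′ w) (sym stopped) W′ , cs′
    ...   | no _     = ⊥-elim stopped

  returning : Fin n → Role
  returning w with w ≟ᶠ q
  ... | yes _ = stop
  ... | no _  = through

  -- If some maximum flow k differs from g on an edge e at q, then k - g is
  -- balanced everywhere and has an edge end leaving q, so walk extraction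
  -- in Γ_g returns to q; it cannot arrive leaving (augmenting walk).
  return-via : ∀ {g k} → Max g → Max k → ∀ e s → end Γ e s ≡ q → ¬ k e ≡ g e → RFwd Γ c g q q
  return-via {g} {k} mg mk@(_ , k≤c , _) e s at-q k≢g =
    finish (walk-from-q returning D (difference-≤cap k≤c) fits fits-q)
    where
    open import Relation.Binary.Reasoning.Setoid ≈ₑ-setoid
    D : REdge Γ → ℕ
    D = difference k g

    D-balanced : ∀ w → endCount D w ≈ₑ 0ᵈ
    D-balanced w = ⊞-cancelˡ (flowEnds g w) (begin
      flowEnds g w ⊞ endCount D w ≈⟨ difference-excess D (difference-represents k g) w ⟨
      flowEnds k w                ≈⟨ max-same-excess mk mg w ⟩
      flowEnds g w                ≈⟨ ≗⇒≈ₑ (λ x → sym (+-identityʳ (flowEnds g w x))) ⟩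
      flowEnds g w ⊞ 0ᵈ           ∎)

    fits : ∀ w → ¬ w ≡ q → Fits (returning w) (endCount D w)
    fits w w≢q with w ≟ᶠ q
    ... | yes w≡q = ⊥-elim (w≢q w≡q)
    ... | no _    = balanced-fits (D-balanced w)

    e-leaves-q : 1 ≤ endsAt Γ e q leave
    e-leaves-q = subst₂ (λ w d → 1 ≤ endsAt Γ e w d) at-q (q-source e s at-q) (end-counted e s)

    -- the copy of e used by D contributes an end leaving q, or one
    -- entering q, which balance turns into one leaving q
    D-leaves-q : 0 < endCount D q leave
    D-leaves-q with <-cmp (k e) (g e)
    ... | tri≈ _ k≡g _ = ⊥-elim (k≢g k≡g)
    ... | tri> _ _ g<k = ≤-trans (*-mono-≤ (m<n⇒0<n∸m g<k) e-leaves-q)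
                                 (∑⊎-term (λ r → D r * rEnds r q leave) (inj₁ e))
    ... | tri< k<g _ _ = ≤-trans (*-mono-≤ (m<n⇒0<n∸m k<g) e-leaves-q)
                           (≤-trans (∑⊎-term (λ r → D r * rEnds r q enter) (inj₂ e))
                                    (≤-reflexive (sym (balanced-fits (D-balanced q)))))

    fits-q : FitsCurrent (returning q) enter (endCount D q)
    fits-q with q ≟ᶠ q
    ... | no q≢q = ⊥-elim (q≢q refl)
    ... | yes _  = D-leaves-q

    finish : (∃[ w ] ∃[ y ] Σ (List (Step Γ c g)) λ ws →
               Walk Γ c g q leave ws w y × Stops (returning w) y × CgSimple Γ c g ws) →
             RFwd Γ c g q q
    finish (w , y , ws , W , stopped , cs) with w ≟ᶠ q
    ... | no _ = ⊥-elim stopped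
    finish (w , leave , ws , W , _ , cs) | yes refl = ⊥-elim (no-augmenting-walk mg W cs)
    finish (w , enter , ws , W , _ , cs) | yes refl = ws , W , cs

  -- If g is not saturated and not empty on an edge e at q, then e forward
  -- and back again is a walk from q back to q.
  there-and-back : ∀ {g} e s → end Γ e s ≡ q → g e < c e → 0 < g e → RFwd Γ c g q q
  there-and-back {g} e s at-q g<c g>0 =
    steps , cast-walk at-q (q-source e s at-q) (trans (cong (end Γ e) (other-other s)) at-q)
                      (cong rev (trans (cong (dir Γ e) (other-other s)) (q-source e s at-q)))
                      (cons (inj₁ e) s g<c (one (inj₂ e) (other s) g>0)) ,
    simple
    where
    open Ends.Walks Γ c g
    other-other : ∀ s → other (other s) ≡ s
    other-other s₁ = refl
    other-other s₂ = refl
    steps : List (Step Γ c g)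
    steps = (inj₁ e , s) ∷ (inj₂ e , other s) ∷ []
    simple : CgSimple Γ c g steps
    simple r with ≡-dec _≟ᶠ_ _≟ᶠ_ r (inj₁ e) | ≡-dec _≟ᶠ_ _≟ᶠ_ r (inj₂ e)
    ... | yes refl | _ rewrite sameR-refl (inj₁ e) | sameR-≢ (inj₁ e) (inj₂ e) (λ ()) = m<n⇒0<n∸m g<c
    ... | no r≢e₁ | yes refl rewrite sameR-≢ (inj₂ e) (inj₁ e) (λ ()) | sameR-refl (inj₂ e) = g>0
    ... | no r≢e₁ | no r≢e₂ rewrite sameR-≢ r (inj₁ e) r≢e₁ | sameR-≢ r (inj₂ e) r≢e₂ = z≤n

  -- A walk in Γ_h leaving q and entering q gives one in Γ_g.  Its first
  -- edge is a forward copy of an edge e at q (q has no entering ends).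
  -- Augmenting h along it gives a maximum flow k; if k or h differs from g
  -- on e use return-via, otherwise g e = h e lies strictly between 0 and c e.
  reach-q : ∀ {g h} → Max g → Max h → RFwd Γ c h q q → RFwd Γ c g q q
  reach-q {g} {h} mg mh@(_ , h≤c , _) (ws , W , cs) with Ends.Walks.first-step Γ c h W
  ... | inj₂ e , s , at-q , dir-leave , _ , _ =
        ⊥-elim (enter≢leave (trans (cong rev (sym (q-source e s at-q))) dir-leave))
    where
    enter≢leave : ¬ enter ≡ leave
    enter≢leave ()
  ... | inj₁ e , s , at-q , _ , h<c , used = by-cases (push ws e ≟ h e) (g e ≟ h e)
    where
    open Augment c h h≤c
    open Ends.Walks Γ c h
    by-cases : Dec (push ws e ≡ h e) → Dec (g e ≡ h e) → RFwd Γ c g q q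
    by-cases (no k≢h)  (yes g≡h) =
      return-via mg (push-max mh W cs) e s at-q (λ k≡g → k≢h (trans k≡g g≡h))
    by-cases _         (no g≢h)  = return-via mg mh e s at-q (g≢h ∘ sym)
    by-cases (yes k≡h) (yes g≡h) = there-and-back e s at-q (subst (_< c e) (sym g≡h) h<c)
                                                           (subst (0 <_) (sym g≡h) h>0)
      where
      -- pushing along ws did not change e, so ws also uses the reverse copy of e
      h>0 : 0 < h e
      h>0 = ≤-trans used (≤-trans (≤-reflexive (+-cancelˡ-≡ (h e) _ _
              (trans (sym (push-represents ws cs e)) (cong (_+ mult ws (inj₂ e)) k≡h)))) (cs (inj₂ e)))

  reach-bwd : ∀ {g h} → Max g → Max h → ∀ v → RBwd Γ c h q v → RBwd Γ c g q v
  reach-bwd mg mh v (ws , W , cs) with v ≟ᶠ q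
  ... | yes refl = ⊥-elim (no-augmenting-walk mh W cs)
  ... | no v≢q   = transfer mg mh v leave v≢q (ws , W , cs)

  reach-fwd : ∀ {g h} → Max g → Max h → ∀ v → RFwd Γ c h q v → RFwd Γ c g q v
  reach-fwd mg mh v (ws , W , cs) with v ≟ᶠ q
  ... | yes refl = reach-q mg mh (ws , W , cs)
  ... | no v≢q   = transfer mg mh v enter v≢q (ws , W , cs)

  RBwd-same : ∀ {g h} → Max g → Max h → ∀ v → RBwd Γ c g q v ⇔ RBwd Γ c h q v
  RBwd-same mg mh v = mk⇔ (reach-bwd mh mg v) (reach-bwd mg mh v)

  RFwd-same : ∀ {g h} → Max g → Max h → ∀ v → RFwd Γ c g q v ⇔ RFwd Γ c h q v
  RFwd-same mg mh v = mk⇔ (reach-fwd mh mg v) (reach-fwd mg mh v)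

  -- An edge of positive capacity has a copy in every residual graph, with the same ends.
  residual-copy : ∀ {g h} → Feasible Γ c g → Feasible Γ c h → ∀ r → InΓg Γ c g r →
                  ∃[ r′ ] (InΓg Γ c h r′ × (∀ s → rend Γ r′ s ≡ rend Γ r s))
  residual-copy {g} {h} g≤c h≤c r r∈ = copy (edge r) (positive r r∈) (λ s → same-ends r s)
    where
    edge : REdge Γ → Fin m
    edge (inj₁ e) = e
    edge (inj₂ e) = e
    same-ends : ∀ r s → end Γ (edge r) s ≡ rend Γ r s
    same-ends (inj₁ e) s = refl
    same-ends (inj₂ e) s = refl
    positive : ∀ r → InΓg Γ c g r → 0 < c (edge r)
    positive (inj₁ e) g<c = ≤-<-trans z≤n g<c
    positive (inj₂ e) g>0 = ≤-trans g>0 (g≤c e)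
    copy : ∀ e → 0 < c e → (∀ s → end Γ e s ≡ rend Γ r s) →
           ∃[ r′ ] (InΓg Γ c h r′ × (∀ s → rend Γ r′ s ≡ rend Γ r s))
    copy e c>0 ends with h e <? c e
    ... | yes h<c = inj₁ e , h<c , ends
    ... | no h≮c  = inj₂ e , subst (0 <_) (sym (≤-antisym (h≤c e) (≮⇒≥ h≮c))) c>0 , ends

  Both-same : ∀ {g h} → Max g → Max h → ∀ v → Both Γ c g q v ⇔ Both Γ c h q v
  Both-same mg mh v = RFwd-same mg mh v ×-⇔ RBwd-same mg mh v

  adjacency : ∀ {g h} → Max g → Max h → ∀ u v → Adj Γ c g q u v → Adj Γ c h q u v
  adjacency mg@(_ , g≤c , _) mh@(_ , h≤c , _) u v (Bu , Bv , r , s , r∈ , at-u , at-v)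
    with residual-copy g≤c h≤c r r∈
  ... | r′ , r′∈ , ends = Equivalence.to (Both-same mg mh u) Bu , Equivalence.to (Both-same mg mh v) Bv ,
                          r′ , s , r′∈ , trans (ends s) at-u , trans (ends (other s)) at-v

  component : ∀ {g h} → Max g → Max h → ∀ B → IsComponent Γ c g q B → IsComponent Γ c h q B
  component mg mh B (x , Bx , reach) = x , Equivalence.to (Both-same mg mh x) Bx , λ y →
    mk⇔ (λ y∈B → Star.map (adjacency mg mh _ _) (Equivalence.to (reach y) y∈B))
        (λ path → Equivalence.from (reach y) (Star.map (adjacency mh mg _ _) path))

-- Flipping equivalent node sets gives the same graph.  Membership in the
-- flipped set need not be decidable: directions are, so it suffices to
-- refute that they differ.
flip-unique : ∀ {n m} (Γ : BiGraph n m) {X Y : Fin n → Set} (Γ₁ Γ₂ : BiGraph n m) →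
  (∀ v → X v ⇔ Y v) → IsFlipOf Γ X Γ₁ → IsFlipOf Γ Y Γ₂ → Γ₁ ≅G Γ₂
flip-unique Γ {X} {Y} Γ₁ Γ₂ X⇔Y flip₁ flip₂ e s =
  trans (proj₁ (flip₁ e s)) (sym (proj₁ (flip₂ e s))) ,
  decidable-stable (dir Γ₁ e s ≟ᵈ dir Γ₂ e s) not-different
  where
  open Equivalence
  w = end Γ e s
  not-different : ¬ ¬ dir Γ₁ e s ≡ dir Γ₂ e s
  not-different differ = differ (trans (proj₂ (proj₂ (flip₁ e s)) w∉X)
                                       (sym (proj₂ (proj₂ (flip₂ e s)) (w∉X ∘ from (X⇔Y w)))))
    where
    w∉X : ¬ X w
    w∉X w∈X = differ (trans (proj₁ (proj₂ (flip₁ e s)) w∈X)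
                            (sym (proj₁ (proj₂ (flip₂ e s)) (to (X⇔Y w) w∈X))))

theorem5p4 : {n m : ℕ} (Γ : BiGraph n m) (q : Fin n) (c : Fin m → ℕ) →
    (∀ e s → end Γ e s ≡ q → dir Γ e s ≡ leave) →
    (g h : Fin m → ℕ) → IsMaxQFlow Γ q c g → IsMaxQFlow Γ q c h →
    (∀ v → RBwd Γ c g q v ⇔ RBwd Γ c h q v) ×
    (∀ v → RFwd Γ c g q v ⇔ RFwd Γ c h q v) ×
    (∀ v → Aset Γ c g q v ⇔ Aset Γ c h q v) ×
    (∀ v → Mset Γ c g q v ⇔ Mset Γ c h q v) ×
    (∀ (B : Subset n) → IsComponent Γ c g q B ⇔ IsComponent Γ c h q B) ×
    (∀ (Γ₁ Γ₂ : BiGraph n m) → IsFlipOf Γ (FlipSet Γ c g q) Γ₁ →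
      IsFlipOf Γ (FlipSet Γ c h q) Γ₂ → Γ₁ ≅G Γ₂)
theorem5p4 Γ q c q-source g h mg mh =
  Rb , Rf ,
  (λ v → (Rf v ×-⇔ ¬-cong-⇔ (Rb v)) ⊎-⇔ (Rb v ×-⇔ ¬-cong-⇔ (Rf v))) ,
  (λ v → ¬-cong-⇔ (Rf v) ×-⇔ ¬-cong-⇔ (Rb v)) ,
  (λ B → mk⇔ (component mg mh B) (component mh mg B)) ,
  (λ Γ₁ Γ₂ → flip-unique Γ Γ₁ Γ₂ (λ v → Rb v ×-⇔ ¬-cong-⇔ (Rf v)))
  where
  open Uniqueness Γ q c q-source
  Rb = RBwd-same mg mh
  Rf = RFwd-same mg mh
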